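{- Let $G$ be a connected bipartite graph with color classes $E$ and $V$, let $\mathbf f$ be a hypertree of the hypergraph $(V,E)$ and let $\Gamma$ be a spanning tree of $G$ realizing $\mathbf f$. Let $E'\subseteq E$ be tight at $\mathbf f$. Consider the partition of $E'$ according to the connected components of $\Gamma|_{E'}$. Then every part $E''$ of this partition is tight at $\mathbf f$, i.e. $\sum_{e\in E''}\mathbf f(e)=\mu(E'')$.
   Context: A hypertree of $(V,E)$ is a function $\mathbf f\colon E\to\mathbb N$ such that some spanning tree of $G$ has degree $\mathbf f(e)+1$ at each $e\in E$; such a spanning tree realizes $\mathbf f$. For a subgraph $H$ of $G$ (e.g. $H=G$ or $H=\Gamma$) and $E'\subseteq E$, $H|_{E'}$ denotes the subgraph consisting of $E'$, all edges of $H$ incident to elements of $E'$, and their endpoints in $V$. For $E'\subseteq E$ let $\mu(\varnothing)=0$ and otherwise $\mu(E')=|\bigcup E'|-c(E')$, where $\bigcup E'$ is the set of vertices of $V$ in $G|_{E'}$ and $c(E')$ is the number of connected components of $G|_{E'}$. A set $E'\subseteq E$ is tight at $\mathbf f$ if $\sum_{e\in E'}\mathbf f(e)=\mu(E')$. -}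

module Defs where

open import Data.Nat using (ℕ; zero; suc; _+_; _<ᵇ_)
open import Data.Bool using (Bool; true; false; _∧_; _∨_; not; if_then_else_)
open import Data.Fin using (Fin; zero; suc; toℕ; splitAt)
open import Data.Fin.Properties using (_≟_)
open import Data.Sum using (_⊎_; inj₁; inj₂)
open import Data.Product using (Σ; _×_)
open import Data.Integer using (ℤ; +_; _-_)
open import Relation.Nullary.Decidable using (⌊_⌋)
open import Relation.Binary.PropositionalEquality using (_≡_)

sumFin : ∀ {k} → (Fin k → ℕ) → ℕ
sumFin {zero}  g = 0
sumFin {suc k} g = g zero + sumFin (λ i → g (suc i))

anyFin : ∀ {k} → (Fin k → Bool) → Bool
anyFin {zero}  p = false
anyFin {suc k} p = p zero ∨ anyFin (λ i → p (suc i))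

countFin : ∀ {k} → (Fin k → Bool) → ℕ
countFin p = sumFin (λ i → if p i then 1 else 0)

-- A bipartite graph with colour classes E = Fin m and V = Fin n is given
-- by its edge predicate  Fin m → Fin n → Bool ; subgraphs likewise.
BGraph : ℕ → ℕ → Set
BGraph m n = Fin m → Fin n → Bool

Vtx : ℕ → ℕ → Set
Vtx m n = Fin m ⊎ Fin n

eqV : ∀ {m n} → Vtx m n → Vtx m n → Bool
eqV (inj₁ a) (inj₁ b) = ⌊ a ≟ b ⌋
eqV (inj₂ a) (inj₂ b) = ⌊ a ≟ b ⌋
eqV _ _ = false

adj : ∀ {m n} → BGraph m n → Vtx m n → Vtx m n → Bool
adj K (inj₁ e) (inj₂ v) = K e v
adj K (inj₂ v) (inj₁ e) = K e v
adj K _ _ = false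

anyV : ∀ {m n} → (Vtx m n → Bool) → Bool
anyV p = anyFin (λ e → p (inj₁ e)) ∨ anyFin (λ v → p (inj₂ v))

reachWithin : ∀ {m n} → BGraph m n → ℕ → Vtx m n → Vtx m n → Bool
reachWithin K zero    x y = eqV x y
reachWithin K (suc k) x y = reachWithin K k x y ∨ anyV (λ z → reachWithin K k x z ∧ adj K z y)

-- x and y lie in the same connected component (walks have length < m + n).
reach : ∀ {m n} → BGraph m n → Vtx m n → Vtx m n → Bool
reach {m} {n} K = reachWithin K (m + n)

-- Number of connected components of the graph with vertex set P and edge set K
-- (all edges of K assumed to have endpoints in P): number of vertices of P
-- that are the first vertex (in a fixed enumeration of E ⊎ V) of their component.
components : ∀ {m n} → (Vtx m n → Bool) → BGraph m n → ℕ
components {m} {n} P K = countFin rep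
  where
  toV : Fin (m + n) → Vtx m n
  toV = splitAt m
  rep : Fin (m + n) → Bool
  rep i = P (toV i) ∧ not (anyFin (λ j → (toℕ j <ᵇ toℕ i) ∧ P (toV j) ∧ reach K (toV j) (toV i)))

Connected : ∀ {m n} → BGraph m n → Set
Connected K = ∀ x y → reach K x y ≡ true

edgeCount : ∀ {m n} → BGraph m n → ℕ
edgeCount K = sumFin (λ e → countFin (K e))

-- Γ is a spanning tree of G: subgraph of G on all vertices, connected,
-- with |edges| = |vertices| - 1 (i.e. connected and acyclic).
SpanningTree : ∀ {m n} → BGraph m n → BGraph m n → Set
SpanningTree {m} {n} G Γ =
  (∀ e v → Γ e v ≡ true → G e v ≡ true) × Connected Γ × (edgeCount Γ + 1 ≡ m + n)

deg : ∀ {m n} → BGraph m n → Fin m → ℕ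
deg K e = countFin (K e)

Realizes : ∀ {m n} → BGraph m n → (Fin m → ℕ) → Set
Realizes Γ f = ∀ e → deg Γ e ≡ suc (f e)

IsHypertree : ∀ {m n} → BGraph m n → (Fin m → ℕ) → Set
IsHypertree G f = Σ _ (λ Γ → SpanningTree G Γ × Realizes Γ f)

-- H|_{E'} : edges of H incident to E' (vertex set handled separately).
restrictE : ∀ {m n} → BGraph m n → (Fin m → Bool) → BGraph m n
restrictE H E' e v = E' e ∧ H e v

restrictV : ∀ {m n} → BGraph m n → (Fin m → Bool) → Vtx m n → Bool
restrictV H E' (inj₁ e) = E' e
restrictV H E' (inj₂ v) = anyFin (λ e → E' e ∧ H e v)

unionSize : ∀ {m n} → BGraph m n → (Fin m → Bool) → ℕ
unionSize G E' = countFin (λ v → restrictV G E' (inj₂ v))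

-- μ(E') = |⋃E'| - c(E')  (this is 0 for E' = ∅ automatically)
μ : ∀ {m n} → BGraph m n → (Fin m → Bool) → ℤ
μ G E' = + unionSize G E' - + components (restrictV G E') (restrictE G E')

sumOver : ∀ {m} → (Fin m → ℕ) → (Fin m → Bool) → ℕ
sumOver f E' = sumFin (λ e → if E' e then f e else 0)

Tight : ∀ {m n} → BGraph m n → (Fin m → ℕ) → (Fin m → Bool) → Set
Tight G f E' = + sumOver f E' ≡ μ G E'

part : ∀ {m n} → BGraph m n → (Fin m → Bool) → Fin m → (Fin m → Bool)
part Γ E' e₀ e = E' e ∧ reach (restrictE Γ E') (inj₁ e₀) (inj₁ e)

-- For a subgraph K of a spanning tree Γ, the number of components plus the number of edges
-- equals the number of vertices: adding an edge merges at most two components, so this quantity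
-- is monotone in K, and it is m + n both for the empty graph and for Γ. For Γ|E', which has
-- Σ (f + 1) edges on |E'| + |⋃E'| vertices, this reads Σ_{E'} f + c(Γ|E') = |⋃E'|. Hence E' is
-- tight iff Γ|E' ⊆ G|E' have equally many components, i.e. the same components. A part E'' is
-- then spanned by Γ|E'' (every vertex of G|E'' is joined to E'' by an edge of G|E', hence by a
-- path of Γ|E'), so both Γ|E'' and G|E'' are connected, and the identity for E'' says it is tight.

module Submission where

open import Defs
open import Algebra.Properties.CommutativeSemigroup using (interchange)
open import Data.Bool using (Bool; true; false; _∧_; _∨_; not; if_then_else_)
open import Data.Bool.Properties using (∧-conicalˡ; ∧-conicalʳ; ∨-identityʳ; ∨-zeroʳ; not-injective; T-≡)
open import Data.Empty using (⊥-elim)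
open import Data.Fin using (Fin; zero; suc; toℕ; splitAt; join)
open import Data.Fin.Properties using (_≟_; suc-injective; toℕ-injective; splitAt-join; join-splitAt)
import Data.Integer as ℤ
import Data.Integer.Properties as ℤ
open import Data.Nat using (ℕ; zero; suc; _+_; _≤_; _<_; _<ᵇ_; _<?_; _≤′_; ≤′-refl; ≤′-step; z≤n; s≤s)
open import Data.Nat.Properties hiding (_≟_; suc-injective)
open import Data.Product using (Σ-syntax; _×_; _,_; proj₁; proj₂)
open import Data.Sum using (_⊎_; inj₁; inj₂; map₁)
open import Function using (_∘_; case_of_; Equivalence; _⇔_; mk⇔)
open import Relation.Binary.PropositionalEquality
open import Relation.Nullary using (yes; no)
open import Relation.Nullary.Decidable using (⌊_⌋; isYes≗does; dec-true; dec-false)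

∧-intro : ∀ {a b} → a ≡ true → b ≡ true → a ∧ b ≡ true
∧-intro refl refl = refl

∨-introˡ : ∀ {a} b → a ≡ true → a ∨ b ≡ true
∨-introˡ b refl = refl

∨-introʳ : ∀ a {b} → b ≡ true → a ∨ b ≡ true
∨-introʳ true  _    = refl
∨-introʳ false refl = refl

∨-elim : ∀ a {b} → a ∨ b ≡ true → a ≡ true ⊎ b ≡ true
∨-elim true  _ = inj₁ refl
∨-elim false h = inj₂ h

∧-absorbˡ : ∀ a b → (b ≡ true → a ≡ true) → a ∧ b ≡ b
∧-absorbˡ true  b     _ = refl
∧-absorbˡ false false _ = refl
∧-absorbˡ false true  h = h refl

∧-not-false : ∀ {a} b → a ≡ true → a ∧ not b ≡ false → b ≡ true
∧-not-false true  _    _ = refl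
∧-not-false false refl ()

∧-not-antitone : ∀ a {b c} → (b ≡ true → c ≡ true) → a ∧ not c ≡ true → a ∧ not b ≡ true
∧-not-antitone true {false} _   _ = refl
∧-not-antitone true {true}  b⇒c h with b⇒c refl
∧-not-antitone true {true}  b⇒c () | refl

bool-ext : ∀ {a b} → (a ≡ true → b ≡ true) → (b ≡ true → a ≡ true) → a ≡ b
bool-ext {true}  f _ = sym (f refl)
bool-ext {false} {true}  _ g = g refl
bool-ext {false} {false} _ _ = refl

≟-refl : ∀ {k} (a : Fin k) → ⌊ a ≟ a ⌋ ≡ true
≟-refl a = trans (isYes≗does (a ≟ a)) (dec-true (a ≟ a) refl)

≟-false : ∀ {k} (a b : Fin k) → a ≢ b → ⌊ a ≟ b ⌋ ≡ false
≟-false a b a≢b = trans (isYes≗does (a ≟ b)) (dec-false (a ≟ b) a≢b)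

≟-sound : ∀ {k} (a b : Fin k) → ⌊ a ≟ b ⌋ ≡ true → a ≡ b
≟-sound a b h with a ≟ b
... | yes a≡b = a≡b

<ᵇ-sound : ∀ a b → (a <ᵇ b) ≡ true → a < b
<ᵇ-sound a b h = <ᵇ⇒< a b (Equivalence.from T-≡ h)

<ᵇ-complete : ∀ {a b} → a < b → (a <ᵇ b) ≡ true
<ᵇ-complete a<b = Equivalence.to T-≡ (<⇒<ᵇ a<b)

+-≡-⇔-≡-+ : ∀ s u c → ℤ.+ s ≡ ℤ.+ u ℤ.- ℤ.+ c ⇔ s + c ≡ u
+-≡-⇔-≡-+ s u c = mk⇔ to from
  where
  open ≡-Reasoning
  to : ℤ.+ s ≡ ℤ.+ u ℤ.- ℤ.+ c → s + c ≡ u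
  to eq = ℤ.+-injective (begin
    ℤ.+ (s + c)                         ≡⟨ ℤ.pos-+ s c ⟩
    ℤ.+ s ℤ.+ ℤ.+ c                     ≡⟨ cong (λ i → i ℤ.+ ℤ.+ c) eq ⟩
    ℤ.+ u ℤ.- ℤ.+ c ℤ.+ ℤ.+ c           ≡⟨ ℤ.+-assoc (ℤ.+ u) (ℤ.- ℤ.+ c) (ℤ.+ c) ⟩
    ℤ.+ u ℤ.+ (ℤ.- ℤ.+ c ℤ.+ ℤ.+ c)     ≡⟨ cong (λ i → ℤ.+ u ℤ.+ i) (ℤ.+-inverseˡ (ℤ.+ c)) ⟩
    ℤ.+ u ℤ.+ ℤ.0ℤ                      ≡⟨ ℤ.+-identityʳ (ℤ.+ u) ⟩
    ℤ.+ u                               ∎)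
  from : s + c ≡ u → ℤ.+ s ≡ ℤ.+ u ℤ.- ℤ.+ c
  from refl = begin
    ℤ.+ s                               ≡⟨ ℤ.+-identityʳ (ℤ.+ s) ⟨
    ℤ.+ s ℤ.+ ℤ.0ℤ                      ≡⟨ cong (λ i → ℤ.+ s ℤ.+ i) (ℤ.+-inverseʳ (ℤ.+ c)) ⟨
    ℤ.+ s ℤ.+ (ℤ.+ c ℤ.- ℤ.+ c)         ≡⟨ ℤ.+-assoc (ℤ.+ s) (ℤ.+ c) (ℤ.- ℤ.+ c) ⟨
    ℤ.+ s ℤ.+ ℤ.+ c ℤ.- ℤ.+ c           ≡⟨ cong (λ i → i ℤ.- ℤ.+ c) (ℤ.pos-+ s c) ⟨
    ℤ.+ (s + c) ℤ.- ℤ.+ c               ∎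

indicator : Bool → ℕ
indicator b = if b then 1 else 0

indicator-mono : ∀ {a b} → (a ≡ true → b ≡ true) → indicator a ≤ indicator b
indicator-mono {false} _ = z≤n
indicator-mono {true}  h rewrite h refl = ≤-refl

sumFin-cong : ∀ {k} {g h : Fin k → ℕ} → (∀ i → g i ≡ h i) → sumFin g ≡ sumFin h
sumFin-cong {zero}  _  = refl
sumFin-cong {suc k} eq = cong₂ _+_ (eq zero) (sumFin-cong (λ i → eq (suc i)))

sumFin-mono : ∀ {k} {g h : Fin k → ℕ} → (∀ i → g i ≤ h i) → sumFin g ≤ sumFin h
sumFin-mono {zero}  _  = z≤n
sumFin-mono {suc k} le = +-mono-≤ (le zero) (sumFin-mono (λ i → le (suc i)))

sumFin-+ : ∀ {k} (g h : Fin k → ℕ) → sumFin (λ i → g i + h i) ≡ sumFin g + sumFin h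
sumFin-+ {zero}  g h = refl
sumFin-+ {suc k} g h rewrite sumFin-+ (λ i → g (suc i)) (λ i → h (suc i)) =
  interchange +-commutativeSemigroup (g zero) (h zero) (sumFin (λ i → g (suc i))) (sumFin (λ i → h (suc i)))

sumFin-zero : ∀ {k} → sumFin {k} (λ _ → 0) ≡ 0
sumFin-zero {zero}  = refl
sumFin-zero {suc k} = sumFin-zero {k}

sumFin-suc-at : ∀ {k} (g h : Fin k → ℕ) i₀ → (∀ i → i ≢ i₀ → g i ≡ h i) → g i₀ ≡ suc (h i₀) →
  sumFin g ≡ suc (sumFin h)
sumFin-suc-at g h zero eq eq₀
  rewrite eq₀ | sumFin-cong {g = λ i → g (suc i)} {h = λ i → h (suc i)} (λ i → eq (suc i) λ ()) = refl
sumFin-suc-at g h (suc i₀) eq eq₀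
  rewrite eq zero (λ ())
        | sumFin-suc-at (λ i → g (suc i)) (λ i → h (suc i)) i₀ (λ i i≢i₀ → eq (suc i) (i≢i₀ ∘ suc-injective)) eq₀
  = +-suc (h zero) _

sumFin-splitAt : ∀ m {n} (g : Fin m ⊎ Fin n → ℕ) →
  sumFin (λ i → g (splitAt m i)) ≡ sumFin (λ a → g (inj₁ a)) + sumFin (λ b → g (inj₂ b))
sumFin-splitAt zero    g = refl
sumFin-splitAt (suc m) g =
  trans (cong (g (inj₁ zero) +_) (sumFin-splitAt m (g ∘ map₁ suc))) (sym (+-assoc (g (inj₁ zero)) _ _))

countFin-cong : ∀ {k} {p q : Fin k → Bool} → (∀ i → p i ≡ q i) → countFin p ≡ countFin q
countFin-cong eq = sumFin-cong (λ i → cong indicator (eq i))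

countFin-mono : ∀ {k} {p q : Fin k → Bool} → (∀ i → p i ≡ true → q i ≡ true) → countFin p ≤ countFin q
countFin-mono p⊆q = sumFin-mono (λ i → indicator-mono (p⊆q i))

countFin-≤ : ∀ {k} (p : Fin k → Bool) → countFin p ≤ k
countFin-≤ {zero}  p = z≤n
countFin-≤ {suc k} p with p zero
... | true  = s≤s (countFin-≤ (λ i → p (suc i)))
... | false = m≤n⇒m≤1+n (countFin-≤ (λ i → p (suc i)))

countFin-pos : ∀ {k} (p : Fin k → Bool) i → p i ≡ true → 1 ≤ countFin p
countFin-pos p zero    h rewrite h = s≤s z≤n
countFin-pos p (suc i) h = ≤-trans (countFin-pos (λ j → p (suc j)) i h) (m≤n+m _ (indicator (p zero)))

countFin-< : ∀ {k} {p q : Fin k → Bool} → (∀ i → p i ≡ true → q i ≡ true) →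
  ∀ i → p i ≡ false → q i ≡ true → countFin p < countFin q
countFin-< p⊆q zero    pᵢ qᵢ rewrite pᵢ | qᵢ = s≤s (countFin-mono (λ i → p⊆q (suc i)))
countFin-< {p = p} {q} p⊆q (suc i) pᵢ qᵢ =
  subst (_≤ indicator (q zero) + countFin (λ j → q (suc j))) (+-suc (indicator (p zero)) _)
    (+-mono-≤ (indicator-mono (p⊆q zero)) (countFin-< (λ j → p⊆q (suc j)) i pᵢ qᵢ))

countFin-≡⇒⊇ : ∀ {k} {p q : Fin k → Bool} → (∀ i → p i ≡ true → q i ≡ true) →
  countFin p ≡ countFin q → ∀ i → q i ≡ true → p i ≡ true
countFin-≡⇒⊇ {p = p} p⊆q eq i qᵢ with p i in pᵢ
... | true  = refl
... | false = ⊥-elim (<-irrefl eq (countFin-< p⊆q i pᵢ qᵢ))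

LostAtMostOnce : ∀ {k} → (Fin k → Bool) → (Fin k → Bool) → Set
LostAtMostOnce {k} p q = ∀ (i j : Fin k) → p i ≡ true → q i ≡ false → p j ≡ true → q j ≡ false → i ≡ j

lostAtMostOnce-tail : ∀ {k} {p q : Fin (suc k) → Bool} → LostAtMostOnce p q → LostAtMostOnce (p ∘ suc) (q ∘ suc)
lostAtMostOnce-tail lost i j pᵢ qᵢ pⱼ qⱼ = suc-injective (lost (suc i) (suc j) pᵢ qᵢ pⱼ qⱼ)

countFin-≤-suc : ∀ {k} (p q : Fin k → Bool) → LostAtMostOnce p q → countFin p ≤ suc (countFin q)
countFin-≤-suc {zero}  p q _ = z≤n
countFin-≤-suc {suc k} p q lost with p zero in p₀ | q zero in q₀
... | true  | true  = s≤s (countFin-≤-suc _ _ (lostAtMostOnce-tail lost))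
... | false | true  = m≤n⇒m≤1+n (countFin-≤-suc _ _ (lostAtMostOnce-tail lost))
... | false | false = countFin-≤-suc _ _ (lostAtMostOnce-tail lost)
... | true  | false = s≤s (countFin-mono kept)
  where
  kept : ∀ i → p (suc i) ≡ true → q (suc i) ≡ true
  kept i pᵢ with q (suc i) in qᵢ
  ... | true  = refl
  ... | false with lost zero (suc i) p₀ q₀ pᵢ qᵢ
  ... | ()

countFin-≤1 : ∀ {k} (p : Fin k → Bool) → (∀ i j → p i ≡ true → p j ≡ true → i ≡ j) → countFin p ≤ 1
countFin-≤1 {k} p unique =
  subst (countFin p ≤_) (cong suc (sumFin-zero {k})) (countFin-≤-suc p (λ _ → false) λ i j a _ c _ → unique i j a c)

countFin-complement : ∀ {k} (p : Fin k → Bool) → countFin p + countFin (λ i → not (p i)) ≡ k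
countFin-complement {zero}  p = refl
countFin-complement {suc k} p with p zero
... | true  = cong suc (countFin-complement (λ i → p (suc i)))
... | false = trans (+-suc (countFin (λ i → p (suc i))) _) (cong suc (countFin-complement (λ i → p (suc i))))

anyFin-witness : ∀ {k} (p : Fin k → Bool) → anyFin p ≡ true → Σ[ i ∈ Fin k ] p i ≡ true
anyFin-witness {suc k} p h with p zero in p₀
... | true  = zero , p₀
... | false with anyFin-witness (λ i → p (suc i)) h
... | i , pᵢ = suc i , pᵢ

anyFin-intro : ∀ {k} (p : Fin k → Bool) i → p i ≡ true → anyFin p ≡ true
anyFin-intro p zero    h rewrite h = refl
anyFin-intro p (suc i) h with p zero
... | true  = refl
... | false = anyFin-intro (λ j → p (suc j)) i h

anyFin-cong : ∀ {k} {p q : Fin k → Bool} → (∀ i → p i ≡ q i) → anyFin p ≡ anyFin q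
anyFin-cong {zero}  _  = refl
anyFin-cong {suc k} eq = cong₂ _∨_ (eq zero) (anyFin-cong (λ i → eq (suc i)))

-- Walks and reachability

_⊆_ : ∀ {m n} → BGraph m n → BGraph m n → Set
K ⊆ L = ∀ e v → K e v ≡ true → L e v ≡ true

module _ {m n : ℕ} where

  eqV-refl : (x : Vtx m n) → eqV x x ≡ true
  eqV-refl (inj₁ a) = ≟-refl a
  eqV-refl (inj₂ a) = ≟-refl a

  eqV-sound : (x y : Vtx m n) → eqV x y ≡ true → x ≡ y
  eqV-sound (inj₁ a) (inj₁ b) h = cong inj₁ (≟-sound a b h)
  eqV-sound (inj₂ a) (inj₂ b) h = cong inj₂ (≟-sound a b h)

  anyV-intro : (p : Vtx m n → Bool) (z : Vtx m n) → p z ≡ true → anyV p ≡ true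
  anyV-intro p (inj₁ e) h = ∨-introˡ _ (anyFin-intro (λ e → p (inj₁ e)) e h)
  anyV-intro p (inj₂ v) h = ∨-introʳ (anyFin (λ e → p (inj₁ e))) (anyFin-intro (λ v → p (inj₂ v)) v h)

  anyV-false : (p : Vtx m n → Bool) → anyV p ≡ false → ∀ z → p z ≡ false
  anyV-false p h z with p z in pz
  ... | false = refl
  ... | true with trans (sym (anyV-intro p z pz)) h
  ... | ()

  anyV-witness : (p : Vtx m n → Bool) → anyV p ≡ true → Σ[ z ∈ Vtx m n ] p z ≡ true
  anyV-witness p h with ∨-elim (anyFin (λ e → p (inj₁ e))) h
  ... | inj₁ h₁ = let (e , pe) = anyFin-witness _ h₁ in inj₁ e , pe
  ... | inj₂ h₂ = let (v , pv) = anyFin-witness _ h₂ in inj₂ v , pv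

  adj-sym : (K : BGraph m n) (x y : Vtx m n) → adj K x y ≡ adj K y x
  adj-sym K (inj₁ _) (inj₁ _) = refl
  adj-sym K (inj₁ _) (inj₂ _) = refl
  adj-sym K (inj₂ _) (inj₁ _) = refl
  adj-sym K (inj₂ _) (inj₂ _) = refl

  adj-mono : {K L : BGraph m n} → K ⊆ L → ∀ x y → adj K x y ≡ true → adj L x y ≡ true
  adj-mono K⊆L (inj₁ e) (inj₂ v) a = K⊆L e v a
  adj-mono K⊆L (inj₂ v) (inj₁ e) a = K⊆L e v a

  countV : (Vtx m n → Bool) → ℕ
  countV p = countFin (λ i → p (splitAt m i))

  countV-< : {p q : Vtx m n → Bool} → (∀ y → p y ≡ true → q y ≡ true) →
    ∀ y → p y ≡ false → q y ≡ true → countV p < countV q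
  countV-< {p} {q} p⊆q y py qy = countFin-< (λ i → p⊆q (splitAt m i)) (join m n y)
    (trans (cong p (splitAt-join m n y)) py) (trans (cong q (splitAt-join m n y)) qy)

  module _ (K : BGraph m n) where

    reachWithin-mono : ∀ {k k′} → k ≤ k′ → ∀ x y → reachWithin K k x y ≡ true → reachWithin K k′ x y ≡ true
    reachWithin-mono {k} k≤k′ x y h = go (≤⇒≤′ k≤k′)
      where
      go : ∀ {k′} → k ≤′ k′ → reachWithin K k′ x y ≡ true
      go ≤′-refl      = h
      go (≤′-step k≤′k′) = ∨-introˡ _ (go k≤′k′)

    reachWithin-refl : ∀ k x → reachWithin K k x x ≡ true
    reachWithin-refl k x = reachWithin-mono {0} {k} z≤n x x (eqV-refl x)

    reachWithin-snoc : ∀ k x z y → reachWithin K k x z ≡ true → adj K z y ≡ true → reachWithin K (suc k) x y ≡ true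
    reachWithin-snoc k x z y h a =
      ∨-introʳ (reachWithin K k x y) (anyV-intro (λ w → reachWithin K k x w ∧ adj K w y) z (∧-intro h a))

    reachWithin-last : ∀ k x y → reachWithin K (suc k) x y ≡ true →
      reachWithin K k x y ≡ true ⊎ Σ[ z ∈ Vtx m n ] reachWithin K k x z ≡ true × adj K z y ≡ true
    reachWithin-last k x y h with ∨-elim (reachWithin K k x y) h
    ... | inj₁ h₁ = inj₁ h₁
    ... | inj₂ h₂ with anyV-witness _ h₂
    ... | z , q = inj₂ (z , ∧-conicalˡ _ _ q , ∧-conicalʳ _ _ q)

    reachWithin-cons : ∀ k x z y → adj K x z ≡ true → reachWithin K k z y ≡ true → reachWithin K (suc k) x y ≡ true
    reachWithin-cons zero x z y a h with eqV-sound z y h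
    ... | refl = reachWithin-snoc 0 x x z (eqV-refl x) a
    reachWithin-cons (suc k) x z y a h with reachWithin-last k z y h
    ... | inj₁ h₁ = ∨-introˡ _ (reachWithin-cons k x z y a h₁)
    ... | inj₂ (w , h₁ , a₁) = reachWithin-snoc (suc k) x w y (reachWithin-cons k x z w a h₁) a₁

    reachWithin-sym : ∀ k x y → reachWithin K k x y ≡ true → reachWithin K k y x ≡ true
    reachWithin-sym zero x y h with eqV-sound x y h
    ... | refl = eqV-refl x
    reachWithin-sym (suc k) x y h with reachWithin-last k x y h
    ... | inj₁ h₁ = ∨-introˡ _ (reachWithin-sym k x y h₁)
    ... | inj₂ (z , h₁ , a) = reachWithin-cons k y z x (trans (adj-sym K y z) a) (reachWithin-sym k x z h₁)

    reachWithin-trans : ∀ k l x y z → reachWithin K k x y ≡ true → reachWithin K l y z ≡ true →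
      reachWithin K (l + k) x z ≡ true
    reachWithin-trans k zero x y z h₁ h₂ with eqV-sound y z h₂
    ... | refl = h₁
    reachWithin-trans k (suc l) x y z h₁ h₂ with reachWithin-last l y z h₂
    ... | inj₁ h = ∨-introˡ _ (reachWithin-trans k l x y z h₁ h)
    ... | inj₂ (w , h , a) = reachWithin-snoc (l + k) x w z (reachWithin-trans k l x y w h₁ h) a

    reachWithin-closed : (S : Vtx m n → Set) → (∀ z w → S z → adj K z w ≡ true → S w) →
      ∀ k x y → reachWithin K k x y ≡ true → S x → S y
    reachWithin-closed S closed zero x y h Sx with eqV-sound x y h
    ... | refl = Sx
    reachWithin-closed S closed (suc k) x y h Sx with reachWithin-last k x y h
    ... | inj₁ h₁ = reachWithin-closed S closed k x y h₁ Sx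
    ... | inj₂ (z , h₁ , a) = closed z y (reachWithin-closed S closed k x z h₁ Sx) a

    -- Walks need not be longer than m + n: the set of vertices reachable from x within k steps
    -- grows strictly until it stabilises, and it has at most m + n elements.
    Stable : Vtx m n → ℕ → Set
    Stable x k = ∀ y → reachWithin K (suc k) x y ≡ true → reachWithin K k x y ≡ true

    stable-forever : ∀ x k → Stable x k → ∀ j y → reachWithin K (j + k) x y ≡ true → reachWithin K k x y ≡ true
    stable-forever x k st zero    y h = h
    stable-forever x k st (suc j) y h with reachWithin-last (j + k) x y h
    ... | inj₁ h₁ = stable-forever x k st j y h₁
    ... | inj₂ (z , h₁ , a) = st y (reachWithin-snoc k x z y (stable-forever x k st j z h₁) a)

    newAt : Vtx m n → ℕ → Vtx m n → Bool
    newAt x k y = reachWithin K (suc k) x y ∧ not (reachWithin K k x y)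

    grows-or-stabilises : ∀ x k → suc k ≤ countV (reachWithin K k x) ⊎ Σ[ k′ ∈ ℕ ] k′ ≤ k × Stable x k′
    grows-or-stabilises x zero =
      inj₁ (countFin-pos _ (join m n x) (trans (cong (eqV x) (splitAt-join m n x)) (eqV-refl x)))
    grows-or-stabilises x (suc k) with grows-or-stabilises x k
    ... | inj₂ (k′ , k′≤k , st) = inj₂ (k′ , m≤n⇒m≤1+n k′≤k , st)
    ... | inj₁ grown with anyV (newAt x k) in new
    ... | false = inj₂ (k , n≤1+n k , λ y h → ∧-not-false (reachWithin K k x y) h (anyV-false (newAt x k) new y))
    ... | true with anyV-witness _ new
    ... | y , q = inj₁ (<-≤-trans (s≤s grown) (countV-< {reachWithin K k x} (λ y → ∨-introˡ _) y
                    (not-injective (∧-conicalʳ (reachWithin K (suc k) x y) _ q))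
                    (∧-conicalˡ (reachWithin K (suc k) x y) _ q)))

    reachWithin⇒reach : ∀ k x y → reachWithin K k x y ≡ true → reach K x y ≡ true
    reachWithin⇒reach k x y h with grows-or-stabilises x (m + n)
    ... | inj₁ tooMany = ⊥-elim (<⇒≱ tooMany (countFin-≤ _))
    ... | inj₂ (k′ , k′≤m+n , st) =
      reachWithin-mono k′≤m+n x y (stable-forever x k′ st k y (reachWithin-mono (m≤m+n k k′) x y h))

    reach-refl : ∀ x → reach K x x ≡ true
    reach-refl = reachWithin-refl (m + n)

    reach-sym : ∀ x y → reach K x y ≡ true → reach K y x ≡ true
    reach-sym = reachWithin-sym (m + n)

    reach-trans : ∀ x y z → reach K x y ≡ true → reach K y z ≡ true → reach K x z ≡ true
    reach-trans x y z h₁ h₂ = reachWithin⇒reach (m + n + (m + n)) x z (reachWithin-trans (m + n) (m + n) x y z h₁ h₂)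

    reach-edge : ∀ x y → adj K x y ≡ true → reach K x y ≡ true
    reach-edge x y a = reachWithin⇒reach 1 x y (reachWithin-snoc 0 x x y (eqV-refl x) a)

    reach-closed : (S : Vtx m n → Set) → (∀ z w → S z → adj K z w ≡ true → S w) →
      ∀ x y → reach K x y ≡ true → S x → S y
    reach-closed S closed = reachWithin-closed S closed (m + n)

  reach-mono : {K L : BGraph m n} → K ⊆ L → ∀ x y → reach K x y ≡ true → reach L x y ≡ true
  reach-mono {K} {L} K⊆L x y r = reach-closed K (λ z → reach L x z ≡ true)
    (λ z w r a → reach-trans L x z w r (reach-edge L z w (adj-mono K⊆L z w a))) x y r (reach-refl L x)

-- Counting components

module _ {m n : ℕ} where

  toV : Fin (m + n) → Vtx m n
  toV = splitAt m

  toV-injective : ∀ i j → toV i ≡ toV j → i ≡ j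
  toV-injective i j eq = trans (sym (join-splitAt m n i)) (trans (cong (join m n) eq) (join-splitAt m n j))

  componentCount : BGraph m n → ℕ
  componentCount = components (λ _ → true)

  EdgesWithin : (Vtx m n → Bool) → BGraph m n → Set
  EdgesWithin P K = ∀ e v → K e v ≡ true → P (inj₁ e) ≡ true × P (inj₂ v) ≡ true

  module _ (P : Vtx m n → Bool) (K : BGraph m n) where

    earlierInComponent : Fin (m + n) → Bool
    earlierInComponent i = anyFin (λ j → (toℕ j <ᵇ toℕ i) ∧ P (toV j) ∧ reach K (toV j) (toV i))

    -- components P K = countFin (isRep P K) holds definitionally.
    isRep : Fin (m + n) → Bool
    isRep i = P (toV i) ∧ not (earlierInComponent i)

    earlier-intro : ∀ i j → toℕ j < toℕ i → P (toV j) ≡ true → reach K (toV j) (toV i) ≡ true →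
      earlierInComponent i ≡ true
    earlier-intro i j j<i pⱼ j~i = anyFin-intro _ j (∧-intro (<ᵇ-complete j<i) (∧-intro pⱼ j~i))

    earlier-witness : ∀ i → earlierInComponent i ≡ true →
      Σ[ j ∈ Fin (m + n) ] toℕ j < toℕ i × P (toV j) ≡ true × reach K (toV j) (toV i) ≡ true
    earlier-witness i h with anyFin-witness _ h
    ... | j , q = j , <ᵇ-sound _ _ (∧-conicalˡ (toℕ j <ᵇ toℕ i) _ q)
                    , ∧-conicalˡ (P (toV j)) _ (∧-conicalʳ (toℕ j <ᵇ toℕ i) _ q)
                    , ∧-conicalʳ (P (toV j)) _ (∧-conicalʳ (toℕ j <ᵇ toℕ i) _ q)

    isRep⇒P : ∀ i → isRep i ≡ true → P (toV i) ≡ true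
    isRep⇒P i = ∧-conicalˡ _ _

    isRep-minimal : ∀ i j → isRep i ≡ true → P (toV j) ≡ true → reach K (toV j) (toV i) ≡ true → toℕ i ≤ toℕ j
    isRep-minimal i j repᵢ pⱼ j~i with toℕ j <? toℕ i
    ... | no  j≮i = ≮⇒≥ j≮i
    ... | yes j<i = case trans (sym (earlier-intro i j j<i pⱼ j~i)) (not-injective (∧-conicalʳ (P (toV i)) _ repᵢ)) of λ ()

    isRep-unique : ∀ i j → isRep i ≡ true → isRep j ≡ true → reach K (toV j) (toV i) ≡ true → i ≡ j
    isRep-unique i j repᵢ repⱼ j~i = toℕ-injective (≤-antisym
      (isRep-minimal i j repᵢ (isRep⇒P j repⱼ) j~i) (isRep-minimal j i repⱼ (isRep⇒P i repᵢ) (reach-sym K _ _ j~i)))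

    isRep-reaches : ∀ i → P (toV i) ≡ true → Σ[ r ∈ Fin (m + n) ] isRep r ≡ true × reach K (toV r) (toV i) ≡ true
    isRep-reaches i = below (suc (toℕ i)) i ≤-refl
      where
      below : ∀ fuel i → toℕ i < fuel → P (toV i) ≡ true →
        Σ[ r ∈ Fin (m + n) ] isRep r ≡ true × reach K (toV r) (toV i) ≡ true
      below (suc fuel) i i<fuel pᵢ with isRep i in repᵢ
      ... | true  = i , repᵢ , reach-refl K (toV i)
      ... | false with earlier-witness i (∧-not-false (earlierInComponent i) pᵢ repᵢ)
      ... | j , j<i , pⱼ , j~i with below fuel j (<-≤-trans j<i (≤-pred i<fuel)) pⱼ
      ... | r , repᵣ , r~j = r , repᵣ , reach-trans K _ _ _ r~j j~i

    isRep-exists : ∀ x → P x ≡ true → Σ[ r ∈ Fin (m + n) ] isRep r ≡ true × reach K (toV r) x ≡ true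
    isRep-exists x pₓ with isRep-reaches (join m n x) (trans (cong P (splitAt-join m n x)) pₓ)
    ... | r , repᵣ , r~x = r , repᵣ , subst (λ y → reach K (toV r) y ≡ true) (splitAt-join m n x) r~x

    components≡1 : ∀ x → P x ≡ true → (∀ u v → P u ≡ true → P v ≡ true → reach K u v ≡ true) → components P K ≡ 1
    components≡1 x pₓ connected with isRep-exists x pₓ
    ... | r , repᵣ , _ = ≤-antisym
      (countFin-≤1 isRep λ i j repᵢ repⱼ → isRep-unique i j repᵢ repⱼ (connected _ _ (isRep⇒P j repⱼ) (isRep⇒P i repᵢ)))
      (countFin-pos isRep r repᵣ)

  components-cong : (P : Vtx m n → Bool) {K L : BGraph m n} → K ⊆ L → L ⊆ K → components P K ≡ components P L
  components-cong P K⊆L L⊆K = countFin-cong λ i → cong (λ b → P (toV i) ∧ not b) (anyFin-cong λ j →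
    cong (λ b → (toℕ j <ᵇ toℕ i) ∧ P (toV j) ∧ b) (bool-ext (reach-mono K⊆L _ _) (reach-mono L⊆K _ _)))

  isRep-antitone : (P : Vtx m n → Bool) {K L : BGraph m n} → K ⊆ L → ∀ i → isRep P L i ≡ true → isRep P K i ≡ true
  isRep-antitone P {K} {L} K⊆L i = ∧-not-antitone (P (toV i)) earlierK⇒earlierL
    where
    earlierK⇒earlierL : earlierInComponent P K i ≡ true → earlierInComponent P L i ≡ true
    earlierK⇒earlierL h with earlier-witness P K i h
    ... | j , j<i , pⱼ , j~i = earlier-intro P L i j j<i pⱼ (reach-mono K⊆L _ _ j~i)

  -- Every representative for L is one for K, so equal counts make the representatives coincide.
  components-≡⇒reach-reflect : (P : Vtx m n → Bool) {K L : BGraph m n} → K ⊆ L → components P K ≡ components P L →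
    ∀ u v → P u ≡ true → P v ≡ true → reach L u v ≡ true → reach K u v ≡ true
  components-≡⇒reach-reflect P {K} {L} K⊆L sameCount u v pᵤ pᵥ u~v
    with isRep-exists P K u pᵤ | isRep-exists P K v pᵥ
  ... | rᵤ , repᵤ , rᵤ~u | rᵥ , repᵥ , rᵥ~v
    with isRep-unique P L rᵤ rᵥ (repsAgree rᵤ repᵤ) (repsAgree rᵥ repᵥ)
           (reach-trans L _ _ _ (reach-mono K⊆L _ _ rᵥ~v) (reach-trans L _ _ _ (reach-sym L _ _ u~v)
             (reach-mono K⊆L _ _ (reach-sym K _ _ rᵤ~u))))
    where
    repsAgree : ∀ i → isRep P K i ≡ true → isRep P L i ≡ true
    repsAgree = countFin-≡⇒⊇ (isRep-antitone P K⊆L) (sym sameCount)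
  ... | refl = reach-trans K _ _ _ (reach-sym K _ _ rᵤ~u) rᵥ~v

  module _ {P : Vtx m n → Bool} {K : BGraph m n} (within : EdgesWithin P K) where

    adj-within : ∀ z w → adj K z w ≡ true → P w ≡ true
    adj-within (inj₁ e) (inj₂ v) a = proj₂ (within e v a)
    adj-within (inj₂ v) (inj₁ e) a = proj₁ (within e v a)

    reach-within : ∀ x y → reach K x y ≡ true → P x ≡ true → P y ≡ true
    reach-within = reach-closed K (λ w → P w ≡ true) (λ z w _ → adj-within z w)

    reach-from-outside : ∀ x y → P x ≡ false → reach K x y ≡ true → x ≡ y
    reach-from-outside x y pₓ x~y = reach-closed K (x ≡_) closed x y x~y refl
      where
      closed : ∀ z w → x ≡ z → adj K z w ≡ true → x ≡ w
      closed z w refl a = case trans (sym (adj-within w z (trans (adj-sym K w z) a))) pₓ of λ ()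

    -- Every vertex outside P is a component of its own.
    componentCount-outside : componentCount K ≡ components P K + countFin (λ i → not (P (toV i)))
    componentCount-outside = trans (sumFin-cong pointwise)
      (sumFin-+ (λ i → indicator (isRep P K i)) (λ i → indicator (not (P (toV i)))))
      where
      pointwise : ∀ i → indicator (isRep (λ _ → true) K i) ≡ indicator (isRep P K i) + indicator (not (P (toV i)))
      pointwise i with P (splitAt m i) in pᵢ
      ... | true  = trans (cong (indicator ∘ not) (anyFin-cong λ j → cong ((toℕ j <ᵇ toℕ i) ∧_)
                      (sym (∧-absorbˡ (P (toV j)) _ λ j~i → reach-within _ _ (reach-sym K _ _ j~i) pᵢ))))
                      (sym (+-identityʳ _))
      ... | false = cong (indicator ∘ not) noEarlier
        where
        noEarlier : earlierInComponent (λ _ → true) K i ≡ false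
        noEarlier with earlierInComponent (λ _ → true) K i in earlier
        ... | false = refl
        ... | true with earlier-witness (λ _ → true) K i earlier
        ... | j , j<i , _ , j~i = ⊥-elim (<⇒≢ j<i (cong toℕ (sym
                (toV-injective i j (reach-from-outside _ _ pᵢ (reach-sym K _ _ j~i))))))

  -- Forests

  edgeCount-mono : {K L : BGraph m n} → K ⊆ L → edgeCount K ≤ edgeCount L
  edgeCount-mono K⊆L = sumFin-mono λ e → countFin-mono (K⊆L e)

  edgeCount-cong : {K L : BGraph m n} → K ⊆ L → L ⊆ K → edgeCount K ≡ edgeCount L
  edgeCount-cong K⊆L L⊆K = sumFin-cong λ e → countFin-cong λ v → bool-ext (K⊆L e v) (L⊆K e v)

  addEdge : BGraph m n → Fin m → Fin n → BGraph m n
  addEdge K e v e′ v′ = K e′ v′ ∨ (⌊ e ≟ e′ ⌋ ∧ ⌊ v ≟ v′ ⌋)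

  module _ (K : BGraph m n) (e : Fin m) (v : Fin n) where

    private
      x y : Vtx m n
      x = inj₁ e
      y = inj₂ v

    addEdge-new : ∀ e′ v′ → ⌊ e ≟ e′ ⌋ ∧ ⌊ v ≟ v′ ⌋ ≡ true → e ≡ e′ × v ≡ v′
    addEdge-new e′ v′ h = ≟-sound e e′ (∧-conicalˡ _ _ h) , ≟-sound v v′ (∧-conicalʳ ⌊ e ≟ e′ ⌋ _ h)

    adj-addEdge : ∀ z w → adj (addEdge K e v) z w ≡ true → adj K z w ≡ true ⊎ (z ≡ x × w ≡ y ⊎ z ≡ y × w ≡ x)
    adj-addEdge (inj₁ e′) (inj₂ v′) a with ∨-elim (K e′ v′) a
    ... | inj₁ old = inj₁ old
    ... | inj₂ new with addEdge-new e′ v′ new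
    ... | refl , refl = inj₂ (inj₁ (refl , refl))
    adj-addEdge (inj₂ v′) (inj₁ e′) a with ∨-elim (K e′ v′) a
    ... | inj₁ old = inj₁ old
    ... | inj₂ new with addEdge-new e′ v′ new
    ... | refl , refl = inj₂ (inj₂ (refl , refl))

    addEdge-⊆ : {L : BGraph m n} → K ⊆ L → L e v ≡ true → addEdge K e v ⊆ L
    addEdge-⊆ K⊆L Lev e′ v′ h with ∨-elim (K e′ v′) h
    ... | inj₁ old = K⊆L e′ v′ old
    ... | inj₂ new with addEdge-new e′ v′ new
    ... | refl , refl = Lev

    ThroughNewEdge : Vtx m n → Vtx m n → Set
    ThroughNewEdge a b = (reach K a x ≡ true × reach K y b ≡ true) ⊎ (reach K a y ≡ true × reach K x b ≡ true)

    reach-addEdge : ∀ a b → reach (addEdge K e v) a b ≡ true → reach K a b ≡ true ⊎ ThroughNewEdge a b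
    reach-addEdge a b a~b = reach-closed (addEdge K e v) Reached closed a b a~b (inj₁ (reach-refl K a))
      where
      Reached : Vtx m n → Set
      Reached b = reach K a b ≡ true ⊎ ThroughNewEdge a b
      closed : ∀ z w → Reached z → adj (addEdge K e v) z w ≡ true → Reached w
      closed z w r a with adj-addEdge z w a | r
      ... | inj₁ old | inj₁ a~z = inj₁ (reach-trans K _ _ _ a~z (reach-edge K z w old))
      ... | inj₁ old | inj₂ (inj₁ (a~x , y~z)) = inj₂ (inj₁ (a~x , reach-trans K _ _ _ y~z (reach-edge K z w old)))
      ... | inj₁ old | inj₂ (inj₂ (a~y , x~z)) = inj₂ (inj₂ (a~y , reach-trans K _ _ _ x~z (reach-edge K z w old)))
      ... | inj₂ (inj₁ (refl , refl)) | inj₁ a~x = inj₂ (inj₁ (a~x , reach-refl K y))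
      ... | inj₂ (inj₁ (refl , refl)) | inj₂ (inj₁ (a~x , _)) = inj₂ (inj₁ (a~x , reach-refl K y))
      ... | inj₂ (inj₁ (refl , refl)) | inj₂ (inj₂ (a~y , _)) = inj₁ a~y
      ... | inj₂ (inj₂ (refl , refl)) | inj₁ a~y = inj₂ (inj₂ (a~y , reach-refl K x))
      ... | inj₂ (inj₂ (refl , refl)) | inj₂ (inj₁ (a~x , _)) = inj₁ a~x
      ... | inj₂ (inj₂ (refl , refl)) | inj₂ (inj₂ (a~y , _)) = inj₂ (inj₂ (a~y , reach-refl K x))

    lostRep : ∀ i → isRep (λ _ → true) K i ≡ true → isRep (λ _ → true) (addEdge K e v) i ≡ false →
      Σ[ j ∈ Fin (m + n) ] toℕ j < toℕ i × ThroughNewEdge (toV j) (toV i)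
    lostRep i rep rep′ with earlier-witness _ _ i (∧-not-false (earlierInComponent _ (addEdge K e v) i) refl rep′)
    ... | j , j<i , _ , j~i with reach-addEdge _ _ j~i
    ... | inj₁ old     = ⊥-elim (<⇒≱ j<i (isRep-minimal _ K i j rep refl old))
    ... | inj₂ through = j , j<i , through

    componentCount-addEdge : componentCount K ≤ suc (componentCount (addEdge K e v))
    componentCount-addEdge = countFin-≤-suc _ _ atMostOneLost
      where
      rep : Fin (m + n) → Bool
      rep = isRep (λ _ → true) K
      -- Two lost representatives reached through the new edge from opposite sides would each
      -- precede the other.
      crossing : ∀ i₁ i₂ j₁ j₂ → rep i₁ ≡ true → rep i₂ ≡ true → toℕ j₁ < toℕ i₁ → toℕ j₂ < toℕ i₂ →
        reach K (toV j₁) (toV i₂) ≡ true → reach K (toV j₂) (toV i₁) ≡ true → i₁ ≡ i₂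
      crossing i₁ i₂ j₁ j₂ r₁ r₂ j₁<i₁ j₂<i₂ j₁~i₂ j₂~i₁ = ⊥-elim (<-irrefl refl (begin-strict
        toℕ j₂ <⟨ j₂<i₂ ⟩
        toℕ i₂ ≤⟨ isRep-minimal _ K i₂ j₁ r₂ refl j₁~i₂ ⟩
        toℕ j₁ <⟨ j₁<i₁ ⟩
        toℕ i₁ ≤⟨ isRep-minimal _ K i₁ j₂ r₁ refl j₂~i₁ ⟩
        toℕ j₂ ∎))
        where open ≤-Reasoning
      atMostOneLost : LostAtMostOnce rep (isRep (λ _ → true) (addEdge K e v))
      atMostOneLost i₁ i₂ r₁ l₁ r₂ l₂ with lostRep i₁ r₁ l₁ | lostRep i₂ r₂ l₂
      ... | j₁ , _ , inj₁ (_ , y~i₁) | j₂ , _ , inj₁ (_ , y~i₂) =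
        isRep-unique _ K i₁ i₂ r₁ r₂ (reach-trans K _ _ _ (reach-sym K _ _ y~i₂) y~i₁)
      ... | j₁ , _ , inj₂ (_ , x~i₁) | j₂ , _ , inj₂ (_ , x~i₂) =
        isRep-unique _ K i₁ i₂ r₁ r₂ (reach-trans K _ _ _ (reach-sym K _ _ x~i₂) x~i₁)
      ... | j₁ , j₁<i₁ , inj₁ (j₁~x , y~i₁) | j₂ , j₂<i₂ , inj₂ (j₂~y , x~i₂) =
        crossing i₁ i₂ j₁ j₂ r₁ r₂ j₁<i₁ j₂<i₂ (reach-trans K _ _ _ j₁~x x~i₂) (reach-trans K _ _ _ j₂~y y~i₁)
      ... | j₁ , j₁<i₁ , inj₂ (j₁~y , x~i₁) | j₂ , j₂<i₂ , inj₁ (j₂~x , y~i₂) =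
        crossing i₁ i₂ j₁ j₂ r₁ r₂ j₁<i₁ j₂<i₂ (reach-trans K _ _ _ j₁~y y~i₂) (reach-trans K _ _ _ j₂~x x~i₁)

    edgeCount-addEdge : K e v ≡ false → edgeCount (addEdge K e v) ≡ suc (edgeCount K)
    edgeCount-addEdge Kev = sumFin-suc-at _ _ e otherRow row
      where
      otherRow : ∀ e′ → e′ ≢ e → countFin (addEdge K e v e′) ≡ countFin (K e′)
      otherRow e′ e′≢e rewrite ≟-false e e′ (e′≢e ∘ sym) = countFin-cong λ v′ → ∨-identityʳ (K e′ v′)
      row : countFin (addEdge K e v e) ≡ suc (countFin (K e))
      row rewrite ≟-refl e = sumFin-suc-at _ _ v
        (λ v′ v′≢v → cong indicator (trans (cong (K e v′ ∨_) (≟-false v v′ (v′≢v ∘ sym))) (∨-identityʳ (K e v′))))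
        (trans (cong indicator (trans (cong (K e v ∨_) (≟-refl v)) (∨-zeroʳ (K e v)))) (cong (suc ∘ indicator) (sym Kev)))

  missing-edge : (K L : BGraph m n) → L ⊆ K ⊎ Σ[ e ∈ Fin m ] Σ[ v ∈ Fin n ] L e v ≡ true × K e v ≡ false
  missing-edge K L with anyFin (λ e → anyFin (λ v → L e v ∧ not (K e v))) in missing
  ... | true = let (e , row) = anyFin-witness _ missing
                   (v , q)   = anyFin-witness _ row
               in inj₂ (e , v , ∧-conicalˡ _ _ q , not-injective (∧-conicalʳ (L e v) _ q))
  ... | false = inj₁ L⊆K
    where
    L⊆K : L ⊆ K
    L⊆K e v Lev with K e v in Kev
    ... | true  = refl
    ... | false = case trans (sym (anyFin-intro _ e (anyFin-intro _ v (∧-intro Lev (cong not Kev))))) missing of λ ()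

  componentCount+edgeCount-mono : {K L : BGraph m n} → K ⊆ L →
    componentCount K + edgeCount K ≤ componentCount L + edgeCount L
  componentCount+edgeCount-mono {K} {L} K⊆L = go _ K K⊆L (m+[n∸m]≡n (edgeCount-mono K⊆L))
    where
    go : ∀ d K → K ⊆ L → edgeCount K + d ≡ edgeCount L → componentCount K + edgeCount K ≤ componentCount L + edgeCount L
    go d K K⊆L gap with missing-edge K L
    ... | inj₁ L⊆K = ≤-reflexive (cong₂ _+_ (components-cong _ K⊆L L⊆K) (edgeCount-cong K⊆L L⊆K))
    ... | inj₂ (e , v , Lev , Kev) = step d gap
      where
      K′ : BGraph m n
      K′ = addEdge K e v
      K′⊆L : K′ ⊆ L
      K′⊆L = addEdge-⊆ K e v K⊆L Lev
      grown : edgeCount K′ ≡ suc (edgeCount K)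
      grown = edgeCount-addEdge K e v Kev
      step : ∀ d → edgeCount K + d ≡ edgeCount L → componentCount K + edgeCount K ≤ componentCount L + edgeCount L
      step zero    gap = ⊥-elim (<-irrefl (trans (sym (+-identityʳ _)) gap) (subst (_≤ _) grown (edgeCount-mono K′⊆L)))
      step (suc d) gap = begin
        componentCount K + edgeCount K        ≤⟨ +-monoˡ-≤ (edgeCount K) (componentCount-addEdge K e v) ⟩
        suc (componentCount K′) + edgeCount K ≡⟨ sym (+-suc (componentCount K′) (edgeCount K)) ⟩
        componentCount K′ + suc (edgeCount K) ≡⟨ cong (componentCount K′ +_) (sym grown) ⟩
        componentCount K′ + edgeCount K′      ≤⟨ go d K′ K′⊆L (trans (cong (_+ d) grown) (trans (sym (+-suc _ d)) gap)) ⟩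
        componentCount L + edgeCount L        ∎
        where open ≤-Reasoning

  emptyGraph : BGraph m n
  emptyGraph _ _ = false

  componentCount-empty : componentCount emptyGraph ≡ m + n
  componentCount-empty =
    trans (componentCount-outside {P = λ _ → false} (λ _ _ ())) (countFin-complement {m + n} (λ _ → false))

  edgeCount-empty : edgeCount emptyGraph ≡ 0
  edgeCount-empty = trans (sumFin-cong {m} (λ _ → sumFin-zero {n})) (sumFin-zero {m})

  subforest-rank : {Γ K : BGraph m n} → Connected Γ → edgeCount Γ + 1 ≡ m + n → K ⊆ Γ →
    componentCount K + edgeCount K ≡ m + n
  subforest-rank {Γ} {K} connected treeEdges K⊆Γ = ≤-antisym
    (begin
      componentCount K + edgeCount K ≤⟨ componentCount+edgeCount-mono K⊆Γ ⟩
      componentCount Γ + edgeCount Γ ≡⟨ cong (_+ edgeCount Γ) (components≡1 _ Γ (toV i₀) refl λ u v _ _ → connected u v) ⟩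
      1 + edgeCount Γ                ≡⟨ +-comm 1 _ ⟩
      edgeCount Γ + 1                ≡⟨ treeEdges ⟩
      m + n                          ∎)
    (begin
      m + n                          ≡⟨ sym (trans (cong₂ _+_ componentCount-empty edgeCount-empty) (+-identityʳ _)) ⟩
      componentCount emptyGraph + edgeCount emptyGraph ≤⟨ componentCount+edgeCount-mono {emptyGraph} (λ _ _ ()) ⟩
      componentCount K + edgeCount K ∎)
    where
    open ≤-Reasoning
    i₀ : Fin (m + n)
    i₀ = subst Fin (trans (+-comm 1 _) treeEdges) zero

  subforest-vertices : {Γ K : BGraph m n} → Connected Γ → edgeCount Γ + 1 ≡ m + n → K ⊆ Γ →
    (P : Vtx m n → Bool) → EdgesWithin P K → edgeCount K + components P K ≡ countFin (λ i → P (toV i))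
  subforest-vertices {Γ} {K} connected treeEdges K⊆Γ P within = +-cancelʳ-≡ outside _ _ (begin
    edgeCount K + components P K + outside   ≡⟨ +-assoc (edgeCount K) _ _ ⟩
    edgeCount K + (components P K + outside) ≡⟨ cong (edgeCount K +_) (sym (componentCount-outside {P = P} within)) ⟩
    edgeCount K + componentCount K           ≡⟨ +-comm (edgeCount K) _ ⟩
    componentCount K + edgeCount K           ≡⟨ subforest-rank connected treeEdges K⊆Γ ⟩
    m + n                                    ≡⟨ sym (countFin-complement (λ i → P (toV i))) ⟩
    countFin (λ i → P (toV i)) + outside     ∎)
    where
    open ≡-Reasoning
    outside : ℕ
    outside = countFin (λ i → not (P (toV i)))

  -- Restrictions to a set of hyperedges

  module _ (A : Fin m → Bool) where

    restrictE-⊆ : (H : BGraph m n) → restrictE H A ⊆ H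
    restrictE-⊆ H e v = ∧-conicalʳ (A e) _

    restrictE-mono : {H H′ : BGraph m n} → H ⊆ H′ → restrictE H A ⊆ restrictE H′ A
    restrictE-mono H⊆H′ e v h = ∧-intro (∧-conicalˡ (A e) _ h) (H⊆H′ e v (∧-conicalʳ (A e) _ h))

    edgesWithin-restrict : {G H : BGraph m n} → H ⊆ G → EdgesWithin (restrictV G A) (restrictE H A)
    edgesWithin-restrict H⊆G e v h =
      ∧-conicalˡ (A e) _ h , anyFin-intro _ e (restrictE-mono H⊆G e v h)

    edgeCount-restrict : {Γ : BGraph m n} {f : Fin m → ℕ} → Realizes Γ f →
      edgeCount (restrictE Γ A) ≡ sumOver f A + countFin A
    edgeCount-restrict {Γ} {f} realizes = trans (sumFin-cong row) (sumFin-+ (λ e → if A e then f e else 0) (indicator ∘ A))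
      where
      row : ∀ e → countFin (λ v → A e ∧ Γ e v) ≡ (if A e then f e else 0) + indicator (A e)
      row e with A e
      ... | true  = trans (realizes e) (+-comm 1 (f e))
      ... | false = sumFin-zero {n}

    vertexCount-restrict : (G : BGraph m n) → countFin (λ i → restrictV G A (toV i)) ≡ countFin A + unionSize G A
    vertexCount-restrict G = sumFin-splitAt m (indicator ∘ restrictV G A)

    sumOver+components≡unionSize : {G Γ : BGraph m n} {f : Fin m → ℕ} → SpanningTree G Γ → Realizes Γ f →
      sumOver f A + components (restrictV G A) (restrictE Γ A) ≡ unionSize G A
    sumOver+components≡unionSize {G} {Γ} {f} (Γ⊆G , connected , treeEdges) realizes = +-cancelˡ-≡ (countFin A) _ _ (begin
      countFin A + (sumOver f A + components PA ΓA) ≡⟨ sym (+-assoc (countFin A) _ _) ⟩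
      countFin A + sumOver f A + components PA ΓA   ≡⟨ cong (_+ components PA ΓA) (+-comm (countFin A) _) ⟩
      sumOver f A + countFin A + components PA ΓA   ≡⟨ cong (_+ components PA ΓA) (edgeCount-restrict realizes) ⟨
      edgeCount ΓA + components PA ΓA               ≡⟨ subforest-vertices connected treeEdges (restrictE-⊆ Γ) PA (edgesWithin-restrict Γ⊆G) ⟩
      countFin (λ i → PA (toV i))                   ≡⟨ vertexCount-restrict G ⟩
      countFin A + unionSize G A                    ∎)
      where
      open ≡-Reasoning
      PA : Vtx m n → Bool
      PA = restrictV G A
      ΓA : BGraph m n
      ΓA = restrictE Γ A

  Tight⇔ : (G : BGraph m n) (f : Fin m → ℕ) (A : Fin m → Bool) →
    Tight G f A ⇔ sumOver f A + components (restrictV G A) (restrictE G A) ≡ unionSize G A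
  Tight⇔ G f A = +-≡-⇔-≡-+ (sumOver f A) (unionSize G A) (components (restrictV G A) (restrictE G A))

  module _ (H : BGraph m n) (A : Fin m → Bool) (e₀ : Fin m) where

    private
      x₀ : Vtx m n
      x₀ = inj₁ e₀
      HA HB : BGraph m n
      HA = restrictE H A
      HB = restrictE H (part H A e₀)

    -- A path of H|A from e₀ uses only edges at elements of its own part.
    reach-part : ∀ w → reach HA x₀ w ≡ true → reach HB x₀ w ≡ true
    reach-part w x₀~w = proj₂ (reach-closed HA Reached closed x₀ w x₀~w (reach-refl HA x₀ , reach-refl HB x₀))
      where
      Reached : Vtx m n → Set
      Reached w = reach HA x₀ w ≡ true × reach HB x₀ w ≡ true
      inPart : ∀ e v → HA e v ≡ true → reach HA x₀ (inj₁ e) ≡ true → HB e v ≡ true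
      inPart e v ev x₀~e = ∧-intro (∧-intro (∧-conicalˡ (A e) _ ev) x₀~e) (∧-conicalʳ (A e) _ ev)
      closed : ∀ z w → Reached z → adj HA z w ≡ true → Reached w
      closed (inj₁ e) (inj₂ v) (x₀~e , x₀~ᴮe) ev =
        reach-trans HA _ _ _ x₀~e (reach-edge HA (inj₁ e) (inj₂ v) ev) ,
        reach-trans HB _ _ _ x₀~ᴮe (reach-edge HB (inj₁ e) (inj₂ v) (inPart e v ev x₀~e))
      closed (inj₂ v) (inj₁ e) (x₀~v , x₀~ᴮv) ve =
        x₀~e , reach-trans HB _ _ _ x₀~ᴮv (reach-edge HB (inj₂ v) (inj₁ e) (inPart e v ve x₀~e))
        where
        x₀~e : reach HA x₀ (inj₁ e) ≡ true
        x₀~e = reach-trans HA _ _ _ x₀~v (reach-edge HA (inj₂ v) (inj₁ e) ve)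

  -- Equal component counts let us replace the G|A-edge from e to v by a path of Γ|A.
  part-reachable : {G Γ : BGraph m n} → Γ ⊆ G → (A : Fin m → Bool) →
    components (restrictV G A) (restrictE Γ A) ≡ components (restrictV G A) (restrictE G A) →
    ∀ e₀ w → restrictV G (part Γ A e₀) w ≡ true → reach (restrictE Γ A) (inj₁ e₀) w ≡ true
  part-reachable {G} {Γ} Γ⊆G A sameCount e₀ (inj₁ e) e∈part = ∧-conicalʳ (A e) _ e∈part
  part-reachable {G} {Γ} Γ⊆G A sameCount e₀ (inj₂ v) v∈part with anyFin-witness _ v∈part
  ... | e , q = reach-trans (restrictE Γ A) _ _ _ (∧-conicalʳ (A e) _ e∈part)
                  (components-≡⇒reach-reflect (restrictV G A) (restrictE-mono A Γ⊆G) sameCount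
                    (inj₁ e) (inj₂ v) e∈A (anyFin-intro _ e ev) (reach-edge (restrictE G A) (inj₁ e) (inj₂ v) ev))
    where
    e∈part : part Γ A e₀ e ≡ true
    e∈part = ∧-conicalˡ (part Γ A e₀ e) _ q
    e∈A : A e ≡ true
    e∈A = ∧-conicalˡ (A e) _ e∈part
    ev : restrictE G A e v ≡ true
    ev = ∧-intro e∈A (∧-conicalʳ (part Γ A e₀ e) _ q)

  tight⇒sameComponents : {G Γ : BGraph m n} {f : Fin m → ℕ} → SpanningTree G Γ → Realizes Γ f →
    (A : Fin m → Bool) → Tight G f A →
    components (restrictV G A) (restrictE Γ A) ≡ components (restrictV G A) (restrictE G A)
  tight⇒sameComponents {G} {Γ} {f} tree realizes A tight = +-cancelˡ-≡ (sumOver f A) _ _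
    (trans (sumOver+components≡unionSize A tree realizes) (sym (Equivalence.to (Tight⇔ G f A) tight)))

  part-spanned : {G Γ : BGraph m n} → Γ ⊆ G → (A : Fin m → Bool) →
    components (restrictV G A) (restrictE Γ A) ≡ components (restrictV G A) (restrictE G A) →
    ∀ e₀ u v → restrictV G (part Γ A e₀) u ≡ true → restrictV G (part Γ A e₀) v ≡ true →
    reach (restrictE Γ (part Γ A e₀)) u v ≡ true
  part-spanned {G} {Γ} Γ⊆G A sameCount e₀ u v u∈P v∈P =
    reach-trans ΓB _ _ _ (reach-sym ΓB _ _ (fromRoot u u∈P)) (fromRoot v v∈P)
    where
    ΓB : BGraph m n
    ΓB = restrictE Γ (part Γ A e₀)
    fromRoot : ∀ w → restrictV G (part Γ A e₀) w ≡ true → reach ΓB (inj₁ e₀) w ≡ true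
    fromRoot w w∈P = reach-part Γ A e₀ w (part-reachable Γ⊆G A sameCount e₀ w w∈P)

lemma2p9 : (m n : ℕ) (G : BGraph m n) → Connected G →
    (f : Fin m → ℕ) → IsHypertree G f →
    (Γ : BGraph m n) → SpanningTree G Γ → Realizes Γ f →
    (E' : Fin m → Bool) → Tight G f E' →
    (e₀ : Fin m) → E' e₀ ≡ true →
    Tight G f (part Γ E' e₀)
-- The hypotheses on G and f are implied by the spanning tree Γ.
lemma2p9 m n G _ f _ Γ tree@(Γ⊆G , _ , _) realizes E' tight e₀ e₀∈E' =
  Equivalence.from (Tight⇔ G f E'') (begin
    sumOver f E'' + components P (restrictE G E'') ≡⟨ cong (sumOver f E'' +_) (components≡1 P _ x₀ x₀∈P spannedᴳ) ⟩
    sumOver f E'' + 1                              ≡⟨ cong (sumOver f E'' +_) (components≡1 P _ x₀ x₀∈P spanned) ⟨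
    sumOver f E'' + components P (restrictE Γ E'') ≡⟨ sumOver+components≡unionSize E'' tree realizes ⟩
    unionSize G E''                                ∎)
  where
  open ≡-Reasoning
  E'' : Fin m → Bool
  E'' = part Γ E' e₀
  P : Vtx m n → Bool
  P = restrictV G E''
  x₀ : Vtx m n
  x₀ = inj₁ e₀
  x₀∈P : P x₀ ≡ true
  x₀∈P = ∧-intro e₀∈E' (reach-refl (restrictE Γ E') x₀)
  spanned : ∀ u v → P u ≡ true → P v ≡ true → reach (restrictE Γ E'') u v ≡ true
  spanned = part-spanned Γ⊆G E' (tight⇒sameComponents tree realizes E' tight) e₀
  spannedᴳ : ∀ u v → P u ≡ true → P v ≡ true → reach (restrictE G E'') u v ≡ true
  spannedᴳ u v u∈P v∈P = reach-mono (restrictE-mono E'' Γ⊆G) u v (spanned u v u∈P v∈P)
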